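{- Let $a,b,n$ be positive integers. If there exists a $(b,a,n)$ strategy for the GKS game, then there exists a $(b,\lfloor b/a\rfloor\cdot n)$ strategy for the GKS game.
   Context: The GKS game with parameter $n$: an adversary (Merlin) holds a permutation $\pi=\pi_1\pi_2\ldots\pi_n$ of $[n]=\{1,\ldots,n\}$ and a bit $b$. Alice has a strategy $S$ mapping partial permutations of $[n]$ (sequences $\pi_1\ldots\pi_i$ of distinct elements of $[n]$) to $\{0,1\}$, and Bob has a strategy $T:\{0,1\}^n\to 2^{[n]}$. An array $A[1..n]$ is filled as follows: for $1\le i\le n-1$, Alice sets $A[\pi_i]=S(\pi_1\ldots\pi_i)$; finally Merlin sets $A[\pi_n]=b$. Let $A_{\rm final}\in\{0,1\}^n$ be the resulting array. The pair $(S,T)$ is a valid strategy if $\pi_n\in T(A_{\rm final})$ for every permutation $\pi$ and every bit $b$. A $(k,n)$ strategy is a valid strategy $(S,T)$ for parameter $n$ such that additionally $|T(\sigma)|\le k$ for every $\sigma\in\{0,1\}^n$. A $(k,k_A,n)$ strategy is a $(k,n)$ strategy $(S,T)$ together with an extension of Alice's strategy $S$ to full permutations (an "Alice-mode"): in Alice-mode, Alice also sets the last entry, $A[\pi_n]=S(\pi_1\ldots\pi_n)$, instead of Merlin (all earlier entries are set exactly as in the usual mode). Let $\mathcal{O}_A\subseteq\{0,1\}^n$ be the set of arrays that can arise at the end of Alice-mode (over all permutations $\pi$). The additional requirement is that $|T(\sigma)|\le k_A$ for every $\sigma\in\mathcal{O}_A$. (Bob's strategy $T$ is the same function in both modes;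 Bob does not know which mode was used.) -}

module Defs where

open import Data.Nat using (ℕ; _≤_)
open import Data.Bool using (Bool; false)
open import Data.Fin using (Fin)
open import Data.Fin.Subset using (Subset; _∈_; ∣_∣)
open import Data.List using (List; []; _∷_; _++_; [_]; _∷ʳ_; length)
open import Data.List.Relation.Unary.Unique.Propositional using (Unique)
open import Data.Vec using (Vec; replicate; _[_]≔_)
open import Data.Product using (Σ; _×_)
open import Relation.Binary.PropositionalEquality using (_≡_)

Array : ℕ → Set
Array n = Vec Bool n

IsPerm : (n : ℕ) → List (Fin n) → Set
IsPerm n π = Unique π × (length π ≡ n)

-- Alice's strategy: a map from (partial) permutations to bits.  It is given on all
-- lists; only its values on sequences of distinct elements are ever used.  Its values
-- on full permutations are the "Alice-mode" extension.
AliceStrat : ℕ → Set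
AliceStrat n = List (Fin n) → Bool

BobStrat : ℕ → Set
BobStrat n = Array n → Subset n

-- Filling the array.  'pre' is the prefix π₁…π_{i-1} already processed, 'rest' the
-- remaining πᵢ…πₙ.
fill : ∀ {n} → AliceStrat n → Bool → List (Fin n) → List (Fin n) → Array n → Array n
fill S b pre [] A = A
fill S b pre (x ∷ []) A = A [ x ]≔ b
fill S b pre (x ∷ y ∷ ys) A = fill S b (pre ∷ʳ x) (y ∷ ys) (A [ x ]≔ S (pre ∷ʳ x))

-- Final array in the usual mode (Merlin sets the last entry to b).
-- (The initial contents are irrelevant: every entry is overwritten.)
finalArray : ∀ {n} → AliceStrat n → Bool → List (Fin n) → Array n
finalArray {n} S b π = fill S b [] π (replicate n false)

aliceFinalArray : ∀ {n} → AliceStrat n → List (Fin n) → Array n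
aliceFinalArray S π = finalArray S (S π) π

Valid : ∀ {n} → AliceStrat n → BobStrat n → Set
Valid {n} S T = ∀ (ps : List (Fin n)) (x : Fin n) → IsPerm n (ps ∷ʳ x) →
  ∀ (b : Bool) → x ∈ T (finalArray S b (ps ∷ʳ x))

IsStrategy2 : (k n : ℕ) → AliceStrat n → BobStrat n → Set
IsStrategy2 k n S T = Valid S T × (∀ (σ : Array n) → ∣ T σ ∣ ≤ k)

Strategy2 : (k n : ℕ) → Set
Strategy2 k n = Σ (AliceStrat n) λ S → Σ (BobStrat n) λ T → IsStrategy2 k n S T

Strategy3 : (k kA n : ℕ) → Set
Strategy3 k kA n = Σ (AliceStrat n) λ S → Σ (BobStrat n) λ T →
  IsStrategy2 k n S T ×
  (∀ (π : List (Fin n)) → IsPerm n π → ∣ T (aliceFinalArray S π) ∣ ≤ kA)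

module Submission where

-- With q = ⌊b/a⌋, view the board [q·n] as q blocks of n cells
-- (cell x is position 'pos x' of block 'blk x', via Fin.combine/remQuot) and
-- play q copies of the given (b,a,n) strategy (S,T) side by side.
--   * Alice answers each move with S applied to the earlier moves of the same
--     block.  A counting argument shows that the moves of a full permutation
--     restricted to any block form a permutation of [n].  Hence, when the last
--     move falls into block j*, block j* was played in the usual mode (its last
--     cell set by Merlin) and every other block was played completely in
--     Alice-mode.
--   * Bob applies T to every block.  Blocks other than j* yield at most a
--     candidates, so a block with more than a candidates can only be j*: then
--     Bob answers with that block alone (≤ b candidates); otherwise he answers
--     with all blocks (≤ q·a ≤ b candidates).  Either way block j* is kept, and
--     it contains the last move because (S,T) is valid.

open import Defs
open import Data.Nat using (ℕ; _<_; _*_; _/_)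
open import Data.Nat.Base using (>-nonZero)
open import Data.Nat using (zero; suc; _+_; _≤_; _<?_; _≤?_; z≤n)
import Data.Nat.Properties as NP
open import Data.Nat.DivMod using (m/n*n≤m)
open import Data.Bool using (Bool; true; false; if_then_else_)
open import Data.Fin as F using (Fin; combine; remQuot; punchIn)
import Data.Fin.Properties as FP
open import Data.Fin.Subset using (Subset; ⊥; ∣_∣; inside; _∈_)
open import Data.Fin.Subset.Properties using (∣⊥∣≡0)
open import Data.List as L using (List; []; _∷_; _++_; [_]; _∷ʳ_; length; last; initLast; _∷ʳ′_)
import Data.List.Properties as LP
open import Data.List.Relation.Unary.All as All using (All; []; _∷_)
open import Data.List.Relation.Unary.AllPairs using ([]; _∷_)
open import Data.List.Relation.Unary.Unique.Propositional using (Unique)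
open import Data.List.Membership.Propositional.Properties using (∈-lookup)
open import Data.Vec as V using (Vec; lookup; tabulate; concat; replicate; _[_]≔_)
import Data.Vec.Properties as VP
open import Data.Vec.Functional using (removeAt)
open import Data.Maybe using (just; maybe)
open import Data.Product using (_,_; proj₁; proj₂; ∃)
open import Data.Empty using (⊥-elim)
open import Relation.Nullary using (Dec; yes; no; does)
open import Relation.Binary.PropositionalEquality
  using (_≡_; _≢_; refl; sym; trans; cong; cong₂; subst; module ≡-Reasoning)
open import Algebra.Properties.CommutativeMonoid.Sum NP.+-0-commutativeMonoid
  using (sum; sum-remove; ∑-distrib-+; sum-cong-≗; sum-replicate-zero)

open ≡-Reasoning

vec-ext : ∀ {A : Set} {m} {u v : Vec A m} → (∀ i → lookup u i ≡ lookup v i) → u ≡ v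
vec-ext {u = u} {v} same =
  trans (sym (VP.tabulate∘lookup u)) (trans (VP.tabulate-cong same) (VP.tabulate∘lookup v))

aliceRun : ∀ {n} → AliceStrat n → List (Fin n) → List (Fin n) → Array n → Array n
aliceRun S pre [] A = A
aliceRun S pre (x ∷ xs) A = aliceRun S (pre ∷ʳ x) xs (A [ x ]≔ S (pre ∷ʳ x))

fill-∷ʳ : ∀ {n} (S : AliceStrat n) b pre ys x A →
  fill S b pre (ys ∷ʳ x) A ≡ aliceRun S pre ys A [ x ]≔ b
fill-∷ʳ S b pre [] x A = refl
fill-∷ʳ S b pre (y ∷ []) x A = refl
fill-∷ʳ S b pre (y ∷ z ∷ zs) x A = fill-∷ʳ S b (pre ∷ʳ y) (z ∷ zs) x (A [ y ]≔ S (pre ∷ʳ y))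

aliceRun-∷ʳ : ∀ {n} (S : AliceStrat n) pre ys x A →
  aliceRun S pre (ys ∷ʳ x) A ≡ aliceRun S pre ys A [ x ]≔ S (pre ++ ys ∷ʳ x)
aliceRun-∷ʳ S pre [] x A = refl
aliceRun-∷ʳ S pre (y ∷ ys) x A =
  trans (aliceRun-∷ʳ S (pre ∷ʳ y) ys x (A [ y ]≔ S (pre ∷ʳ y)))
        (cong (λ σ → aliceRun S (pre ∷ʳ y) ys (A [ y ]≔ S (pre ∷ʳ y)) [ x ]≔ S σ)
              (LP.++-assoc pre [ y ] (ys ∷ʳ x)))

aliceFinalArray-run : ∀ {n} (S : AliceStrat n) π →
  aliceFinalArray S π ≡ aliceRun S [] π (replicate n false)
aliceFinalArray-run {n} S π with initLast π
... | [] = refl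
... | ys ∷ʳ′ x = trans (fill-∷ʳ S (S (ys ∷ʳ x)) [] ys x (replicate n false))
                      (sym (aliceRun-∷ʳ S [] ys x (replicate n false)))

sum-single : ∀ {q} (f : Fin q → ℕ) k → (∀ j → j ≢ k → f j ≡ 0) → sum f ≡ f k
sum-single {suc q} f k vanish = begin
  sum f                     ≡⟨ sum-remove {i = k} f ⟩
  f k + sum (removeAt f k)  ≡⟨ cong (f k +_) (sum-cong-≗ λ j → vanish (punchIn k j) (FP.punchInᵢ≢i k j)) ⟩
  f k + sum {q} (λ _ → 0)   ≡⟨ cong (f k +_) (sum-replicate-zero q) ⟩
  f k + 0                   ≡⟨ NP.+-identityʳ (f k) ⟩
  f k                       ∎

sum-≤ : ∀ {q} (f : Fin q → ℕ) c → (∀ j → f j ≤ c) → sum f ≤ q * c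
sum-≤ {zero} f c bound = z≤n
sum-≤ {suc q} f c bound = NP.+-mono-≤ (bound F.zero) (sum-≤ (λ j → f (F.suc j)) c (λ j → bound (F.suc j)))

sum-tight : ∀ {q} (f : Fin q → ℕ) c → (∀ j → f j ≤ c) → sum f ≡ q * c → ∀ k → f k ≡ c
sum-tight {suc q} f c bound total k = NP.≤-antisym (bound k) c≤fk
  where
  rest : ℕ
  rest = sum (removeAt f k)
  rest≤ : rest ≤ q * c
  rest≤ = sum-≤ (removeAt f k) c (λ j → bound (punchIn k j))
  c≤fk : c ≤ f k
  c≤fk = NP.+-cancelʳ-≤ (q * c) c (f k)
    (NP.≤-trans (NP.≤-reflexive (trans (sym total) (sum-remove {i = k} f))) (NP.+-monoʳ-≤ (f k) rest≤))

unique-lookup : ∀ {A : Set} (xs : List A) → Unique xs → ∀ i j → L.lookup xs i ≡ L.lookup xs j → i ≡ j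
unique-lookup (x ∷ xs) (x∉ ∷ u) F.zero    F.zero    e = refl
unique-lookup (x ∷ xs) (x∉ ∷ u) F.zero    (F.suc j) e = ⊥-elim (All.lookup x∉ (∈-lookup j) e)
unique-lookup (x ∷ xs) (x∉ ∷ u) (F.suc i) F.zero    e = ⊥-elim (All.lookup x∉ (∈-lookup i) (sym e))
unique-lookup (x ∷ xs) (x∉ ∷ u) (F.suc i) (F.suc j) e = cong F.suc (unique-lookup xs u i j e)

unique-length-≤ : ∀ {n} (xs : List (Fin n)) → Unique xs → length xs ≤ n
unique-length-≤ {n} xs u with length xs ≤? n
... | yes short = short
... | no long with FP.pigeonhole (NP.≰⇒> long) (L.lookup xs)
...   | i , j , i<j , same = ⊥-elim (FP.<⇒≢ i<j (unique-lookup xs u i j same))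

∣++∣ : ∀ {k l} (xs : Subset k) (ys : Subset l) → ∣ xs V.++ ys ∣ ≡ ∣ xs ∣ + ∣ ys ∣
∣++∣ V.[] ys = refl
∣++∣ (true V.∷ xs) ys = cong suc (∣++∣ xs ys)
∣++∣ (false V.∷ xs) ys = ∣++∣ xs ys

∣concat∣ : ∀ {q k} (g : Fin q → Subset k) → ∣ concat (tabulate g) ∣ ≡ sum (λ j → ∣ g j ∣)
∣concat∣ {zero} g = refl
∣concat∣ {suc q} g = trans (∣++∣ (g F.zero) (concat (tabulate (λ j → g (F.suc j)))))
                            (cong (∣ g F.zero ∣ +_) (∣concat∣ (λ j → g (F.suc j))))

last-∷ʳ : ∀ {A : Set} (xs : List A) x → last (xs ∷ʳ x) ≡ just x
last-∷ʳ [] x = refl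
last-∷ʳ (y ∷ []) x = refl
last-∷ʳ (y ∷ z ∷ zs) x = last-∷ʳ (z ∷ zs) x

module Pruning (a : ℕ) {q m : ℕ} (g : Fin q → Subset m) where

  keepOnly : Fin q → Fin q → Subset m
  keepOnly k j = if does (j F.≟ k) then g j else ⊥

  pruneBy : Dec (∃ λ j → a < ∣ g j ∣) → Fin q → Subset m
  pruneBy (yes (k , _)) = keepOnly k
  pruneBy (no _) = g

  prune : Fin q → Subset m
  prune = pruneBy (FP.any? (λ j → a <? ∣ g j ∣))

  keepOnly-other : ∀ k j → j ≢ k → ∣ keepOnly k j ∣ ≡ 0
  keepOnly-other k j j≢k with j F.≟ k
  ... | yes j≡k = ⊥-elim (j≢k j≡k)
  ... | no _ = ∣⊥∣≡0 m

  keepOnly-self : ∀ k → keepOnly k k ≡ g k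
  keepOnly-self k with k F.≟ k
  ... | yes _ = refl
  ... | no k≢k = ⊥-elim (k≢k refl)

  prune-size : ∀ b → (∀ j → ∣ g j ∣ ≤ b) → q * a ≤ b → sum (λ j → ∣ prune j ∣) ≤ b
  prune-size b g≤b qa≤b = go (FP.any? (λ j → a <? ∣ g j ∣))
    where
    go : ∀ d → sum (λ j → ∣ pruneBy d j ∣) ≤ b
    go (yes (k , _)) = NP.≤-trans
      (NP.≤-reflexive (trans (sum-single (λ j → ∣ keepOnly k j ∣) k (keepOnly-other k))
                             (cong ∣_∣ (keepOnly-self k))))
      (g≤b k)
    go (no none) = NP.≤-trans (sum-≤ _ a (λ j → NP.≮⇒≥ (λ a<gj → none (j , a<gj)))) qa≤b

  prune-keeps : ∀ k → (∀ j → j ≢ k → ∣ g j ∣ ≤ a) → prune k ≡ g k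
  prune-keeps k small = go (FP.any? (λ j → a <? ∣ g j ∣))
    where
    go : ∀ d → pruneBy d k ≡ g k
    go (yes (k' , a<gk')) with k' F.≟ k
    ... | yes refl = keepOnly-self k
    ... | no k'≢k = ⊥-elim (NP.<⇒≱ a<gk' (small k' k'≢k))
    go (no _) = refl

module Blocks (q n : ℕ) where

  blk : Fin (q * n) → Fin q
  blk x = proj₁ (remQuot {q} n x)

  pos : Fin (q * n) → Fin n
  pos x = proj₂ (remQuot {q} n x)

  blk-combine : ∀ j p → blk (combine j p) ≡ j
  blk-combine j p = cong proj₁ (FP.remQuot-combine {q} {n} j p)

  pos-combine : ∀ j p → pos (combine j p) ≡ p
  pos-combine j p = cong proj₂ (FP.remQuot-combine {q} {n} j p)

  combine-blk-pos : ∀ x → combine (blk x) (pos x) ≡ x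
  combine-blk-pos x = FP.combine-remQuot {q} n x

  blk-pos-injective : ∀ {x y} → blk x ≡ blk y → pos x ≡ pos y → x ≡ y
  blk-pos-injective {x} {y} eb ep =
    trans (sym (combine-blk-pos x)) (trans (cong₂ combine eb ep) (combine-blk-pos y))

  block : Fin q → Array (q * n) → Array n
  block j A = tabulate (λ p → lookup A (combine j p))

  lookup-block : ∀ j (A : Array (q * n)) p → lookup (block j A) p ≡ lookup A (combine j p)
  lookup-block j A p = VP.lookup∘tabulate (λ p → lookup A (combine j p)) p

  block-update-in : ∀ (A : Array (q * n)) x c →
    block (blk x) (A [ x ]≔ c) ≡ block (blk x) A [ pos x ]≔ c
  block-update-in A x c = vec-ext entry
    where
    entry : ∀ p → lookup (block (blk x) (A [ x ]≔ c)) p ≡ lookup (block (blk x) A [ pos x ]≔ c) p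
    entry p with p F.≟ pos x
    ... | yes refl = begin
      lookup (block (blk x) (A [ x ]≔ c)) (pos x)  ≡⟨ lookup-block (blk x) (A [ x ]≔ c) (pos x) ⟩
      lookup (A [ x ]≔ c) (combine (blk x) (pos x)) ≡⟨ cong (lookup (A [ x ]≔ c)) (combine-blk-pos x) ⟩
      lookup (A [ x ]≔ c) x                         ≡⟨ VP.lookup∘update x A c ⟩
      c                                             ≡⟨ sym (VP.lookup∘update (pos x) (block (blk x) A) c) ⟩
      lookup (block (blk x) A [ pos x ]≔ c) (pos x) ∎
    ... | no p≢pos = begin
      lookup (block (blk x) (A [ x ]≔ c)) p  ≡⟨ lookup-block (blk x) (A [ x ]≔ c) p ⟩
      lookup (A [ x ]≔ c) (combine (blk x) p) ≡⟨ VP.lookup∘update′ elsewhere A c ⟩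
      lookup A (combine (blk x) p)            ≡⟨ sym (lookup-block (blk x) A p) ⟩
      lookup (block (blk x) A) p              ≡⟨ sym (VP.lookup∘update′ p≢pos (block (blk x) A) c) ⟩
      lookup (block (blk x) A [ pos x ]≔ c) p ∎
      where
      elsewhere : combine (blk x) p ≢ x
      elsewhere e = p≢pos (trans (sym (pos-combine (blk x) p)) (cong pos e))

  block-update-out : ∀ (A : Array (q * n)) x c j → blk x ≢ j → block j (A [ x ]≔ c) ≡ block j A
  block-update-out A x c j blk≢j = vec-ext λ p → begin
    lookup (block j (A [ x ]≔ c)) p  ≡⟨ lookup-block j (A [ x ]≔ c) p ⟩
    lookup (A [ x ]≔ c) (combine j p) ≡⟨ VP.lookup∘update′ (λ e → blk≢j (trans (cong blk (sym e)) (blk-combine j p))) A c ⟩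
    lookup A (combine j p)            ≡⟨ sym (lookup-block j A p) ⟩
    lookup (block j A) p              ∎

  block-replicate : ∀ j → block j (replicate (q * n) false) ≡ replicate n false
  block-replicate j = vec-ext λ p →
    trans (lookup-block j (replicate (q * n) false) p) (trans (VP.lookup-replicate (combine j p) false) (sym (VP.lookup-replicate p false)))

  restrict : Fin q → List (Fin (q * n)) → List (Fin n)
  restrict j [] = []
  restrict j (x ∷ xs) = if does (blk x F.≟ j) then pos x ∷ restrict j xs else restrict j xs

  restrict-∷ʳ-in : ∀ j pre x → blk x ≡ j → restrict j (pre ∷ʳ x) ≡ restrict j pre ∷ʳ pos x
  restrict-∷ʳ-in j [] x blk≡j with blk x F.≟ j
  ... | yes _ = refl
  ... | no blk≢j = ⊥-elim (blk≢j blk≡j)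
  restrict-∷ʳ-in j (y ∷ pre) x blk≡j with blk y F.≟ j
  ... | yes _ = cong (pos y ∷_) (restrict-∷ʳ-in j pre x blk≡j)
  ... | no _ = restrict-∷ʳ-in j pre x blk≡j

  restrict-∷ʳ-out : ∀ j pre x → blk x ≢ j → restrict j (pre ∷ʳ x) ≡ restrict j pre
  restrict-∷ʳ-out j [] x blk≢j with blk x F.≟ j
  ... | yes blk≡j = ⊥-elim (blk≢j blk≡j)
  ... | no _ = refl
  restrict-∷ʳ-out j (y ∷ pre) x blk≢j with blk y F.≟ j
  ... | yes _ = cong (pos y ∷_) (restrict-∷ʳ-out j pre x blk≢j)
  ... | no _ = restrict-∷ʳ-out j pre x blk≢j

  restrict-∉ : ∀ j x π → blk x ≡ j → All (x ≢_) π → All (pos x ≢_) (restrict j π)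
  restrict-∉ j x [] blk≡j [] = []
  restrict-∉ j x (y ∷ π) blk≡j (x≢y ∷ x∉π) with blk y F.≟ j
  ... | yes blky≡j = (λ e → x≢y (blk-pos-injective (trans blk≡j (sym blky≡j)) e)) ∷ restrict-∉ j x π blk≡j x∉π
  ... | no _ = restrict-∉ j x π blk≡j x∉π

  restrict-unique : ∀ j π → Unique π → Unique (restrict j π)
  restrict-unique j [] [] = []
  restrict-unique j (x ∷ π) (x∉π ∷ u) with blk x F.≟ j
  ... | yes blk≡j = restrict-∉ j x π blk≡j x∉π ∷ restrict-unique j π u
  ... | no _ = restrict-unique j π u

  -- Every move lies in exactly one block, so block lengths add up to the length.
  hits : Fin (q * n) → Fin q → ℕ
  hits x j = if does (blk x F.≟ j) then 1 else 0

  length-restrict-∷ : ∀ x π j → length (restrict j (x ∷ π)) ≡ hits x j + length (restrict j π)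
  length-restrict-∷ x π j with blk x F.≟ j
  ... | yes _ = refl
  ... | no _ = refl

  sum-hits : ∀ x → sum (hits x) ≡ 1
  sum-hits x = trans (sum-single (hits x) (blk x) miss) (hit (blk x F.≟ blk x))
    where
    miss : ∀ j → j ≢ blk x → hits x j ≡ 0
    miss j j≢blk with blk x F.≟ j
    ... | yes blk≡j = ⊥-elim (j≢blk (sym blk≡j))
    ... | no _ = refl
    hit : (d : Dec (blk x ≡ blk x)) → (if does d then 1 else 0) ≡ 1
    hit (yes _) = refl
    hit (no blk≢blk) = ⊥-elim (blk≢blk refl)

  sum-length-restrict : ∀ π → sum (λ j → length (restrict j π)) ≡ length π
  sum-length-restrict [] = sum-replicate-zero q
  sum-length-restrict (x ∷ π) = begin
    sum (λ j → length (restrict j (x ∷ π)))          ≡⟨ sum-cong-≗ (length-restrict-∷ x π) ⟩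
    sum (λ j → hits x j + length (restrict j π))     ≡⟨ ∑-distrib-+ (hits x) (λ j → length (restrict j π)) ⟩
    sum (hits x) + sum (λ j → length (restrict j π)) ≡⟨ cong₂ _+_ (sum-hits x) (sum-length-restrict π) ⟩
    suc (length π)                                   ∎

  -- A permutation of the big board restricts to a permutation of every block:
  -- each block gets at most n moves and all q·n moves are distributed.
  restrict-perm : ∀ π → IsPerm (q * n) π → ∀ j → IsPerm n (restrict j π)
  restrict-perm π (u , len) j = restrict-unique j π u ,
    sum-tight (λ j → length (restrict j π)) n
      (λ j → unique-length-≤ (restrict j π) (restrict-unique j π u))
      (trans (sum-length-restrict π) len) j

  unionBlocks : (Fin q → Subset n) → Subset (q * n)
  unionBlocks h = concat (tabulate h)

  ∈-unionBlocks : ∀ h x → pos x ∈ h (blk x) → x ∈ unionBlocks h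
  ∈-unionBlocks h x mem = VP.lookup⇒[]= x (unionBlocks h) (begin
    lookup (concat (tabulate h)) x                        ≡⟨ cong (lookup (concat (tabulate h))) (sym (combine-blk-pos x)) ⟩
    lookup (concat (tabulate h)) (combine (blk x) (pos x)) ≡⟨ VP.lookup-concat (tabulate h) (blk x) (pos x) ⟩
    lookup (lookup (tabulate h) (blk x)) (pos x)          ≡⟨ cong (λ v → lookup v (pos x)) (VP.lookup∘tabulate h (blk x)) ⟩
    lookup (h (blk x)) (pos x)                            ≡⟨ VP.[]=⇒lookup mem ⟩
    inside                                                ∎)

  productAlice : AliceStrat n → AliceStrat (q * n)
  productAlice S ℓ = maybe (λ x → S (restrict (blk x) ℓ)) false (last ℓ)

  productAlice-∷ʳ : ∀ S pre x → productAlice S (pre ∷ʳ x) ≡ S (restrict (blk x) pre ∷ʳ pos x)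
  productAlice-∷ʳ S pre x rewrite last-∷ʳ pre x = cong S (restrict-∷ʳ-in (blk x) pre x refl)

  productBob : ℕ → BobStrat n → BobStrat (q * n)
  productBob a T A = unionBlocks (Pruning.prune a (λ j → T (block j A)))

  block-run : ∀ S j pre π A →
    block j (aliceRun (productAlice S) pre π A) ≡ aliceRun S (restrict j pre) (restrict j π) (block j A)
  block-run S j pre [] A = refl
  block-run S j pre (x ∷ π) A with blk x F.≟ j
  ... | yes refl = begin
    block (blk x) (aliceRun S′ (pre ∷ʳ x) π (A [ x ]≔ c))
      ≡⟨ block-run S (blk x) (pre ∷ʳ x) π (A [ x ]≔ c) ⟩
    aliceRun S (restrict (blk x) (pre ∷ʳ x)) (restrict (blk x) π) (block (blk x) (A [ x ]≔ c))
      ≡⟨ cong₂ (λ σ B → aliceRun S σ (restrict (blk x) π) B)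
               (restrict-∷ʳ-in (blk x) pre x refl)
               (trans (block-update-in A x c) (cong (block (blk x) A [ pos x ]≔_) (productAlice-∷ʳ S pre x))) ⟩
    aliceRun S (restrict (blk x) pre ∷ʳ pos x) (restrict (blk x) π)
             (block (blk x) A [ pos x ]≔ S (restrict (blk x) pre ∷ʳ pos x)) ∎
    where
    S′ : AliceStrat (q * n)
    S′ = productAlice S
    c : Bool
    c = S′ (pre ∷ʳ x)
  ... | no blk≢j = begin
    block j (aliceRun (productAlice S) (pre ∷ʳ x) π (A [ x ]≔ c))
      ≡⟨ block-run S j (pre ∷ʳ x) π (A [ x ]≔ c) ⟩
    aliceRun S (restrict j (pre ∷ʳ x)) (restrict j π) (block j (A [ x ]≔ c))
      ≡⟨ cong₂ (λ σ B → aliceRun S σ (restrict j π) B)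
               (restrict-∷ʳ-out j pre x blk≢j) (block-update-out A x c j blk≢j) ⟩
    aliceRun S (restrict j pre) (restrict j π) (block j A) ∎
    where
    c : Bool
    c = productAlice S (pre ∷ʳ x)

  block-final-last : ∀ S b ps x →
    block (blk x) (finalArray (productAlice S) b (ps ∷ʳ x)) ≡ finalArray S b (restrict (blk x) ps ∷ʳ pos x)
  block-final-last S b ps x = begin
    block (blk x) (finalArray (productAlice S) b (ps ∷ʳ x))
      ≡⟨ cong (block (blk x)) (fill-∷ʳ (productAlice S) b [] ps x A₀) ⟩
    block (blk x) (aliceRun (productAlice S) [] ps A₀ [ x ]≔ b)
      ≡⟨ block-update-in (aliceRun (productAlice S) [] ps A₀) x b ⟩
    block (blk x) (aliceRun (productAlice S) [] ps A₀) [ pos x ]≔ b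
      ≡⟨ cong (_[ pos x ]≔ b) (block-run S (blk x) [] ps A₀) ⟩
    aliceRun S [] (restrict (blk x) ps) (block (blk x) A₀) [ pos x ]≔ b
      ≡⟨ cong (λ B → aliceRun S [] (restrict (blk x) ps) B [ pos x ]≔ b) (block-replicate (blk x)) ⟩
    aliceRun S [] (restrict (blk x) ps) (replicate n false) [ pos x ]≔ b
      ≡⟨ sym (fill-∷ʳ S b [] (restrict (blk x) ps) (pos x) (replicate n false)) ⟩
    finalArray S b (restrict (blk x) ps ∷ʳ pos x) ∎
    where
    A₀ : Array (q * n)
    A₀ = replicate (q * n) false

  block-final-other : ∀ S b ps x j → blk x ≢ j →
    block j (finalArray (productAlice S) b (ps ∷ʳ x)) ≡ aliceFinalArray S (restrict j ps)
  block-final-other S b ps x j blk≢j = begin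
    block j (finalArray (productAlice S) b (ps ∷ʳ x))
      ≡⟨ cong (block j) (fill-∷ʳ (productAlice S) b [] ps x A₀) ⟩
    block j (aliceRun (productAlice S) [] ps A₀ [ x ]≔ b)
      ≡⟨ block-update-out (aliceRun (productAlice S) [] ps A₀) x b j blk≢j ⟩
    block j (aliceRun (productAlice S) [] ps A₀)
      ≡⟨ block-run S j [] ps A₀ ⟩
    aliceRun S [] (restrict j ps) (block j A₀)
      ≡⟨ cong (aliceRun S [] (restrict j ps)) (block-replicate j) ⟩
    aliceRun S [] (restrict j ps) (replicate n false)
      ≡⟨ sym (aliceFinalArray-run S (restrict j ps)) ⟩
    aliceFinalArray S (restrict j ps) ∎
    where
    A₀ : Array (q * n)
    A₀ = replicate (q * n) false

  product-valid : ∀ a S T → Valid S T →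
    (∀ π → IsPerm n π → ∣ T (aliceFinalArray S π) ∣ ≤ a) →
    Valid (productAlice S) (productBob a T)
  product-valid a S T valid aliceBound ps x perm b =
    ∈-unionBlocks (Pruning.prune a g) x (subst (pos x ∈_) (sym (Pruning.prune-keeps a g (blk x) others-small)) last-block)
    where
    A : Array (q * n)
    A = finalArray (productAlice S) b (ps ∷ʳ x)
    g : Fin q → Subset n
    g j = T (block j A)
    last-block : pos x ∈ g (blk x)
    last-block = subst (λ B → pos x ∈ T B) (sym (block-final-last S b ps x))
      (valid (restrict (blk x) ps) (pos x)
        (subst (IsPerm n) (restrict-∷ʳ-in (blk x) ps x refl) (restrict-perm (ps ∷ʳ x) perm (blk x))) b)
    others-small : ∀ j → j ≢ blk x → ∣ g j ∣ ≤ a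
    others-small j j≢blk = subst (λ B → ∣ T B ∣ ≤ a) (sym (block-final-other S b ps x j blk≢j))
      (aliceBound (restrict j ps)
        (subst (IsPerm n) (restrict-∷ʳ-out j ps x blk≢j) (restrict-perm (ps ∷ʳ x) perm j)))
      where
      blk≢j : blk x ≢ j
      blk≢j e = j≢blk (sym e)

  productBob-size : ∀ a b T → (∀ σ → ∣ T σ ∣ ≤ b) → q * a ≤ b → ∀ A → ∣ productBob a T A ∣ ≤ b
  productBob-size a b T T≤b qa≤b A =
    subst (_≤ b) (sym (∣concat∣ (Pruning.prune a g))) (Pruning.prune-size a g b (λ j → T≤b (block j A)) qa≤b)
    where
    g : Fin q → Subset n
    g j = T (block j A)

product-strategy : ∀ a b n q → q * a ≤ b → Strategy3 b a n → Strategy2 b (q * n)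
product-strategy a b n q qa≤b (S , T , (valid , T≤b) , aliceBound) =
  productAlice S , productBob a T , product-valid a S T valid aliceBound , productBob-size a b T T≤b qa≤b
  where open Blocks q n

lemma4 : (a b n : ℕ) → (a>0 : 0 < a) → 0 < b → 0 < n →
    Strategy3 b a n → Strategy2 b ((_/_ b a {{>-nonZero a>0}}) * n)
lemma4 a b n a>0 _ _ =
  product-strategy a b n (_/_ b a {{>-nonZero a>0}}) (m/n*n≤m b a {{>-nonZero a>0}})
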